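{- Let $G=(V,E)$ be a graph admitting a $k$-completion such that: every set of pairwise true twins of $G$ has at most $k+1$ vertices; there are no two vertices $u,v$ and more than $k$ induced claws each having $u,v$ among its leaves with pairwise distinct third leaves; and there is no non-adjacent pair $u,v$ with more than $k$ distinct induced $4$-cycles each containing $u,v$ as a non-adjacent pair. Let $B$ be a $K$-join of $G$. Then at most $k^3+4k^2+5k+1$ vertices of $B$ belong to an induced claw or an induced $4$-cycle of $G$.
   Context: Two vertices $u,v$ are true twins if $N[u]=N[v]$ (closed neighborhoods). A claw is $K_{1,3}$ with center the degree-3 vertex and leaves the other three. A proper interval graph is a graph with an interval representation in which no interval strictly contains another; a $k$-completion of $G$ is a set $F$ of at most $k$ non-edges with $G+F$ a proper interval graph. A $K$-join of $G$ is a set $B\subseteq V$ inducing a clique, together with an ordering $b_1,\dots,b_{|B|}$ of $B$, such that for every vertex $v\notin B$ the set $N(v)\cap B$ is either empty, of the form $\{b_1,\dots,b_j\}$, or of the form $\{b_j,\dots,b_{|B|}\}$ for some $j$. (Equivalently, $V\setminus B$ splits into $L,R,C$ with no edges between $B$ and $C$, every vertex of $L\cup R$ having a neighbor in $B$, $N_R(b_i)\subseteq N_R(b_{i+1})$ and $N_L(b_{i+1})\subseteq N_L(b_i)$ for all $i$.) -}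

module Defs where

open import Data.Nat using (ℕ; _≤_; _<_; _+_; _*_; _^_)
open import Data.Fin using (Fin; toℕ)
open import Data.List using (List; length; lookup)
open import Data.List.Membership.Propositional using (_∈_; _∉_)
open import Data.List.Relation.Unary.All using (All)
open import Data.List.Relation.Unary.Unique.Propositional using (Unique)
open import Data.Product using (Σ; ∃; ∃-syntax; _×_; _,_; proj₁; proj₂)
open import Data.Sum using (_⊎_)
open import Relation.Nullary using (¬_; Dec)
open import Relation.Binary.PropositionalEquality using (_≡_; _≢_)
open import Function.Bundles using (_⇔_)

record Graph (n : ℕ) : Set₁ where
  field
    Adj   : Fin n → Fin n → Set
    sym   : ∀ {u v} → Adj u v → Adj v u
    irr   : ∀ {u} → ¬ Adj u u
    dec   : ∀ u v → Dec (Adj u v)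
open Graph public

module _ {n : ℕ} (G : Graph n) where

  TrueTwins : Fin n → Fin n → Set
  TrueTwins u v = ∀ w → (w ≡ u ⊎ Adj G u w) ⇔ (w ≡ v ⊎ Adj G v w)

  Claw : Fin n → Fin n → Fin n → Fin n → Set
  Claw c a b d =
    Adj G c a × Adj G c b × Adj G c d ×
    a ≢ b × a ≢ d × b ≢ d ×
    ¬ Adj G a b × ¬ Adj G a d × ¬ Adj G b d

  C4 : Fin n → Fin n → Fin n → Fin n → Set
  C4 a b c d =
    Adj G a b × Adj G b c × Adj G c d × Adj G d a ×
    a ≢ c × b ≢ d × ¬ Adj G a c × ¬ Adj G b d

  InClaw : Fin n → Set
  InClaw x = ∃[ c ] ∃[ a ] ∃[ b ] ∃[ d ]
    (Claw c a b d × (x ≡ c ⊎ x ≡ a ⊎ x ≡ b ⊎ x ≡ d))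

  InC4 : Fin n → Set
  InC4 x = ∃[ a ] ∃[ b ] ∃[ c ] ∃[ d ]
    (C4 a b c d × (x ≡ a ⊎ x ≡ b ⊎ x ≡ c ⊎ x ≡ d))

  TwinBound : ℕ → Set
  TwinBound m = ∀ (ts : List (Fin n)) → Unique ts →
    (∀ x y → x ∈ ts → y ∈ ts → TrueTwins x y) → length ts ≤ m

  ClawBound : ℕ → Set
  ClawBound k = ∀ (u v : Fin n) (ws : List (Fin n)) → Unique ws →
    All (λ w → ∃[ c ] Claw c u v w) ws → length ws ≤ k

  -- no non-adjacent u, v with more than k distinct induced 4-cycles having
  -- u, v as a non-adjacent pair; such a cycle u-a-v-b-u is determined by
  -- the unordered pair {a,b}, represented as (a , b) with a < b
  C4Bound : ℕ → Set
  C4Bound k = ∀ (u v : Fin n) → ¬ Adj G u v →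
    (ps : List (Fin n × Fin n)) → Unique ps →
    All (λ p → toℕ (proj₁ p) < toℕ (proj₂ p) ×
               C4 u (proj₁ p) v (proj₂ p)) ps →
    length ps ≤ k

  -- K-join: B listed in its order b_1 ... b_|B| (distinct, a clique), and
  -- for each v ∉ B, N(v) ∩ B is a prefix {b_1..b_j} (j = 0: empty) or a
  -- suffix {b_j..b_|B|}.
  KJoin : List (Fin n) → Set
  KJoin bs =
    Unique bs ×
    (∀ x y → x ∈ bs → y ∈ bs → x ≢ y → Adj G x y) ×
    (∀ v → v ∉ bs → ∃[ j ]
      ((∀ i → Adj G v (lookup bs i) ⇔ toℕ i < j) ⊎
       (∀ i → Adj G v (lookup bs i) ⇔ j ≤ toℕ i)))

-- Proper interval graph: closed intervals [l v , r v] (endpoints in ℕ,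
-- w.l.o.g. for finite graphs), distinct vertices adjacent iff their
-- intervals intersect, and no interval strictly contains another.
ProperInterval : {n : ℕ} → (Fin n → Fin n → Set) → Set
ProperInterval {n} E = Σ (Fin n → ℕ) λ l → Σ (Fin n → ℕ) λ r →
  ((∀ v → l v ≤ r v) ×
   (∀ u v → u ≢ v → E u v ⇔ (l u ≤ r v × l v ≤ r u)) ×
   (∀ u v → ¬ (l u ≤ l v × r v ≤ r u × (l u ≢ l v ⊎ r v ≢ r u))))

AddEdges : {n : ℕ} → Graph n → List (Fin n × Fin n) → Fin n → Fin n → Set
AddEdges G F u v = Adj G u v ⊎ (u , v) ∈ F ⊎ (v , u) ∈ F

Completion : {n : ℕ} → Graph n → ℕ → List (Fin n × Fin n) → Set
Completion G k F =
  length F ≤ k ×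
  All (λ p → proj₁ p ≢ proj₂ p ×
             ¬ Adj G (proj₁ p) (proj₂ p)) F ×
  ProperInterval (AddEdges G F)

HasCompletion : {n : ℕ} → Graph n → ℕ → Set
HasCompletion G k = ∃[ F ] Completion G k F

-- Fix a completion F with a proper interval model of G + F. Proper interval graphs
-- have no induced claw or 4-cycle, so every induced claw of G has two leaves joined
-- by F and every induced 4-cycle of G has a diagonal in F. Let W consist of the ends
-- of F and the third leaves of claws through a pair of F; by the claw bound,
-- |W| ≤ k (k + 2). A vertex of B on an induced claw or 4-cycle lies in W, or on a
-- 4-cycle with diagonal in F (at most k per pair of F, by the 4-cycle bound and
-- since B is a clique), or is the centre of a claw with two leaves joined by F.
-- Two centres of the last kind lying neither in W nor on such a 4-cycle are true
-- twins as soon as they have the same neighbours in W ∖ B. The K-join order admits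
-- at most |W ∖ B| + 1 such neighbourhoods on B, and the twin bound allows k + 1
-- centres for each.

module Submission where

open import Defs
open import Level using (Level)
open import Data.Bool using (true; false)
open import Data.Nat using (ℕ; zero; suc; _≤_; _<_; _+_; _*_; _^_; z≤n; s≤s; _≤?_; _<?_)
open import Data.Nat.Properties
open import Data.Nat.ListAction using (sum)
open import Data.Nat.Tactic.RingSolver using (solve-∀)
open import Data.Fin using (Fin; toℕ)
open import Data.Fin.Properties using (any?; toℕ-injective) renaming (_≟_ to _≟ᶠ_)
open import Data.List using (List; []; _∷_; length; filter; map; lookup; _++_; allFin)
open import Data.List.Properties using (filter-notAll; length-++)
open import Data.List.Membership.Propositional using (_∈_; _∉_)
open import Data.List.Membership.Propositional.Properties using (∈-filter⁺; ∈-filter⁻; ∈-++⁺ˡ; ∈-++⁺ʳ; ∈-allFin)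
open import Data.List.Relation.Binary.Subset.Propositional using (_⊆_)
open import Data.List.Relation.Unary.Any using (Any; here; there)
import Data.List.Relation.Unary.Any as Any
open import Data.List.Relation.Unary.Any.Properties using (lookup-index)
open import Data.List.Relation.Unary.All using (All; []; _∷_)
import Data.List.Relation.Unary.All as All
open import Data.List.Relation.Unary.All.Properties using (all-filter; filter⁺)
open import Data.List.Relation.Unary.Unique.Propositional using (Unique; []; _∷_)
import Data.List.Relation.Unary.Unique.Propositional.Properties as Unique
open import Data.Product using (∃-syntax; _×_; _,_; proj₁; proj₂)
open import Data.Sum using (_⊎_; inj₁; inj₂; swap; [_,_]′)
open import Data.Empty using (⊥; ⊥-elim)
open import Function using (_∘_; id)
open import Function.Bundles using (_⇔_; Equivalence; mk⇔)
open import Relation.Nullary using (¬_; Dec; yes; no; does)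
open import Relation.Nullary.Decidable using (¬?; _×-dec_)
open import Relation.Unary using (Pred; Decidable; _∩_)
open import Relation.Binary using (DecidableEquality)
open import Relation.Binary.PropositionalEquality as ≡ using (_≡_; _≢_; refl; ≢-sym)

private
  variable
    a e p : Level
    A : Set a

length-filter-split : {P : Pred A p} (P? : Decidable P) (xs : List A) →
  length xs ≡ length (filter P? xs) + length (filter (¬? ∘ P?) xs)
length-filter-split P? [] = refl
length-filter-split P? (x ∷ xs) with does (P? x)
... | true  = ≡.cong suc (length-filter-split P? xs)
... | false = ≡.trans (≡.cong suc (length-filter-split P? xs)) (≡.sym (+-suc _ _))

Unique-⊆⇒length≤ : DecidableEquality A → {xs ys : List A} →
  Unique xs → xs ⊆ ys → length xs ≤ length ys
Unique-⊆⇒length≤ _≟_ {[]} _ _ = z≤n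
Unique-⊆⇒length≤ _≟_ {x ∷ xs} {ys} (x∉xs ∷ xs!) xs⊆ys =
  ≤-trans (s≤s (Unique-⊆⇒length≤ _≟_ xs! xs⊆ys∖x)) (filter-notAll x≢? ys x∈ys)
  where
  x≢? = λ y → ¬? (y ≟ x)
  xs⊆ys∖x : xs ⊆ filter x≢? ys
  xs⊆ys∖x z∈xs = ∈-filter⁺ x≢? (xs⊆ys (there z∈xs)) λ { refl → All.lookup x∉xs z∈xs refl }
  x∈ys : Any (λ y → ¬ ¬ y ≡ x) ys
  x∈ys = Any.map (λ { refl x≢x → x≢x refl }) (xs⊆ys (here refl))

length≤-fibres : {R : A → A → Set p} (K : ℕ) →
  (∀ ts → Unique ts → (∀ x y → x ∈ ts → y ∈ ts → R x y) → length ts ≤ K) →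
  (f : A → ℕ) (N : ℕ) (ys : List A) → Unique ys → All (λ y → f y < N) ys →
  (∀ {y y′} → y ∈ ys → y′ ∈ ys → f y ≡ f y′ → R y y′) → length ys ≤ N * K
length≤-fibres K bound f zero [] _ _ _ = z≤n
length≤-fibres K bound f zero (y ∷ ys) _ (() ∷ _) _
length≤-fibres K bound f (suc N) ys ys! f<N fibre = begin
    length ys                                 ≡⟨ length-filter-split top? ys ⟩
    length (filter top? ys) + length rest     ≤⟨ +-mono-≤ top-fibre others ⟩
    K + N * K                                 ∎
  where
  open ≤-Reasoning
  top? = λ y → f y ≟ N
  rest = filter (¬? ∘ top?) ys
  top-fibre : length (filter top? ys) ≤ K
  top-fibre = bound _ (Unique.filter⁺ top? ys!) λ x y x∈ y∈ →
    let x∈ys , fx≡N = ∈-filter⁻ top? x∈ ; y∈ys , fy≡N = ∈-filter⁻ top? y∈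
    in fibre x∈ys y∈ys (≡.trans fx≡N (≡.sym fy≡N))
  others : length rest ≤ N * K
  others = length≤-fibres K bound f N rest (Unique.filter⁺ (¬? ∘ top?) ys!)
    (All.tabulate λ y∈ → let y∈ys , fy≢N = ∈-filter⁻ (¬? ∘ top?) y∈
                         in ≤∧≢⇒< (≤-pred (All.lookup f<N y∈ys)) fy≢N)
    (λ y∈ y′∈ → fibre (proj₁ (∈-filter⁻ (¬? ∘ top?) y∈)) (proj₁ (∈-filter⁻ (¬? ∘ top?) y′∈)))

length≤-cover : {E : Set e} {Q : E → A → Set p} (Q? : ∀ c → Decidable (Q c)) (K : ℕ)
  (cs : List E) → (∀ {c} → c ∈ cs → ∀ ys → Unique ys → All (Q c) ys → length ys ≤ K) →
  ∀ ys → Unique ys → All (λ y → Any (λ c → Q c y) cs) ys → length ys ≤ length cs * K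
length≤-cover Q? K [] _ [] _ _ = z≤n
length≤-cover Q? K [] _ (y ∷ ys) _ (() ∷ _)
length≤-cover {Q = Q} Q? K (c ∷ cs) bound ys ys! covered = begin
    length ys                                          ≡⟨ length-filter-split (Q? c) ys ⟩
    length (filter (Q? c) ys) + length rest            ≤⟨ +-mono-≤ in-c others ⟩
    K + length cs * K                                  ∎
  where
  open ≤-Reasoning
  rest = filter (¬? ∘ Q? c) ys
  in-c : length (filter (Q? c) ys) ≤ K
  in-c = bound (here refl) _ (Unique.filter⁺ (Q? c) ys!) (all-filter (Q? c) ys)
  elsewhere : ∀ {y} → ¬ Q c y → Any (λ c′ → Q c′ y) (c ∷ cs) → Any (λ c′ → Q c′ y) cs
  elsewhere ¬q (here q)  = ⊥-elim (¬q q)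
  elsewhere ¬q (there q) = q
  others : length rest ≤ length cs * K
  others = length≤-cover Q? K cs (bound ∘ there) rest (Unique.filter⁺ (¬? ∘ Q? c) ys!)
    (All.tabulate λ y∈ → let y∈ys , ¬q = ∈-filter⁻ (¬? ∘ Q? c) y∈ in elsewhere ¬q (All.lookup covered y∈ys))

All-∩-filter : {P Q : Pred A p} (P? : Decidable P) {xs : List A} →
  All Q xs → All (Q ∩ P) (filter P? xs)
All-∩-filter P? {xs} qs = All.zip (filter⁺ P? qs , all-filter P? xs)

sum-map-mono : (f g : A → ℕ) → (∀ x → f x ≤ g x) → ∀ xs → sum (map f xs) ≤ sum (map g xs)
sum-map-mono f g f≤g []       = z≤n
sum-map-mono f g f≤g (x ∷ xs) = +-mono-≤ (f≤g x) (sum-map-mono f g f≤g xs)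

sum-map-≡⇒≡ : (f g : A → ℕ) → (∀ x → f x ≤ g x) → ∀ xs →
  sum (map f xs) ≡ sum (map g xs) → ∀ {x} → x ∈ xs → f x ≡ g x
sum-map-≡⇒≡ f g f≤g (x ∷ xs) eq = λ where
    (here refl) → fx≡gx
    (there x∈)  → sum-map-≡⇒≡ f g f≤g xs tail-eq x∈
  where
  tail-≤ = sum-map-mono f g f≤g xs
  fx≡gx : f x ≡ g x
  fx≡gx = ≤-antisym (f≤g x) (+-cancelʳ-≤ _ (g x) (f x)
    (≤-trans (≤-reflexive (≡.sym eq)) (+-monoʳ-≤ (f x) tail-≤)))
  tail-eq : sum (map f xs) ≡ sum (map g xs)
  tail-eq = +-cancelˡ-≡ (f x) _ _ (≡.trans eq (≡.cong (_+ _) (≡.sym fx≡gx)))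


module Intervals {V : Set} (l r : V → ℕ) where

  Meet : V → V → Set
  Meet u v = l u ≤ r v × l v ≤ r u

  meet? : ∀ u v → Dec (Meet u v)
  meet? u v = (l u ≤? r v) ×-dec (l v ≤? r u)

  meet-sym : ∀ {u v} → Meet u v → Meet v u
  meet-sym (p , q) = q , p

  _≺_ : V → V → Set
  u ≺ v = r u < l v

  ¬meet⇒≺⊎≻ : ∀ {u v} → ¬ Meet u v → u ≺ v ⊎ v ≺ u
  ¬meet⇒≺⊎≻ {u} {v} ¬m with l u ≤? r v | l v ≤? r u
  ... | no lu≰rv | _        = inj₂ (≰⇒> lu≰rv)
  ... | yes _    | no lv≰ru = inj₁ (≰⇒> lv≰ru)
  ... | yes p    | yes q    = ⊥-elim (¬m (p , q))

  meet-across-gap : ∀ {z x a b} → ¬ Meet z x →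
    Meet z a → Meet z b → Meet x a → Meet x b → Meet a b
  meet-across-gap ¬zx (_ , za) (_ , zb) (xa , _) (xb , _) with ¬meet⇒≺⊎≻ ¬zx
  ... | inj₁ z≺x = ≤-trans za (≤-trans (<⇒≤ z≺x) xb) , ≤-trans zb (≤-trans (<⇒≤ z≺x) xa)
  meet-across-gap ¬zx (za , _) (zb , _) (_ , xa) (_ , xb) | inj₂ x≺z =
    ≤-trans xa (≤-trans (<⇒≤ x≺z) zb) , ≤-trans xb (≤-trans (<⇒≤ x≺z) za)

  module Proper (l≤r : ∀ v → l v ≤ r v)
    (proper : ∀ u v → ¬ (l u ≤ l v × r v ≤ r u × (l u ≢ l v ⊎ r v ≢ r u))) where

    ≺-acyclic : ∀ {a b d} → a ≺ b → b ≺ d → d ≺ a → ⊥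
    ≺-acyclic {a} {b} {d} a≺b b≺d d≺a = <-irrefl refl (begin-strict
      r a <⟨ a≺b ⟩ l b ≤⟨ l≤r b ⟩ r b <⟨ b≺d ⟩ l d ≤⟨ l≤r d ⟩
      r d <⟨ d≺a ⟩ l a ≤⟨ l≤r a ⟩ r a ∎)
      where open ≤-Reasoning

    -- An interval meeting u and v would strictly contain any interval between them.
    ¬meet-around : ∀ {c u m v} → Meet c u → Meet c v → u ≺ m → m ≺ v → ⊥
    ¬meet-around {c} {u} {m} {v} (cu , _) (_ , vc) u≺m m≺v =
      proper c m (<⇒≤ lc<lm , <⇒≤ rm<rc , inj₁ (<⇒≢ lc<lm))
      where
      lc<lm = ≤-<-trans cu u≺m
      rm<rc = <-≤-trans m≺v vc

    claw-free : ∀ {c a b d} → Meet c a → Meet c b → Meet c d →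
      Meet a b ⊎ Meet a d ⊎ Meet b d
    claw-free {c} {a} {b} {d} ca cb cd with meet? a b | meet? a d | meet? b d
    ... | yes ab | _      | _      = inj₁ ab
    ... | no _   | yes ad | _      = inj₂ (inj₁ ad)
    ... | no _   | no _   | yes bd = inj₂ (inj₂ bd)
    ... | no ¬ab | no ¬ad | no ¬bd =
      ⊥-elim (ordered (¬meet⇒≺⊎≻ ¬ab) (¬meet⇒≺⊎≻ ¬ad) (¬meet⇒≺⊎≻ ¬bd))
      where
      ordered : a ≺ b ⊎ b ≺ a → a ≺ d ⊎ d ≺ a → b ≺ d ⊎ d ≺ b → ⊥
      ordered (inj₁ ab) (inj₁ ad) (inj₁ bd) = ¬meet-around ca cd ab bd
      ordered (inj₁ ab) (inj₁ ad) (inj₂ db) = ¬meet-around ca cb ad db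
      ordered (inj₁ ab) (inj₂ da) (inj₁ bd) = ≺-acyclic ab bd da
      ordered (inj₁ ab) (inj₂ da) (inj₂ db) = ¬meet-around cd cb da ab
      ordered (inj₂ ba) (inj₁ ad) (inj₁ bd) = ¬meet-around cb cd ba ad
      ordered (inj₂ ba) (inj₁ ad) (inj₂ db) = ≺-acyclic ba ad db
      ordered (inj₂ ba) (inj₂ da) (inj₁ bd) = ¬meet-around cb ca bd da
      ordered (inj₂ ba) (inj₂ da) (inj₂ db) = ¬meet-around cd ca db ba


module GraphFacts {n : ℕ} (G : Graph n) where

  ¬adj-sym : ∀ {u v} → ¬ Adj G u v → ¬ Adj G v u
  ¬adj-sym ¬uv vu = ¬uv (sym G vu)

  adj⇒≢ : ∀ {u v} → Adj G u v → u ≢ v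
  adj⇒≢ uv refl = irr G uv

  claw? : ∀ c a b d → Dec (Claw G c a b d)
  claw? c a b d = dec G c a ×-dec dec G c b ×-dec dec G c d ×-dec
    ¬? (a ≟ᶠ b) ×-dec ¬? (a ≟ᶠ d) ×-dec ¬? (b ≟ᶠ d) ×-dec
    ¬? (dec G a b) ×-dec ¬? (dec G a d) ×-dec ¬? (dec G b d)

  C4? : ∀ a b c d → Dec (C4 G a b c d)
  C4? a b c d = dec G a b ×-dec dec G b c ×-dec dec G c d ×-dec dec G d a ×-dec
    ¬? (a ≟ᶠ c) ×-dec ¬? (b ≟ᶠ d) ×-dec ¬? (dec G a c) ×-dec ¬? (dec G b d)

  C4-diagonal≢ : ∀ {a b c d} → C4 G a b c d → b ≢ d
  C4-diagonal≢ (_ , _ , _ , _ , _ , b≢d , _ , _) = b≢d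

  C4-¬adj₁₃ : ∀ {a b c d} → C4 G a b c d → ¬ Adj G a c
  C4-¬adj₁₃ (_ , _ , _ , _ , _ , _ , ¬ac , _) = ¬ac

  C4-¬adj₂₄ : ∀ {a b c d} → C4 G a b c d → ¬ Adj G b d
  C4-¬adj₂₄ (_ , _ , _ , _ , _ , _ , _ , ¬bd) = ¬bd

  claw-swap : ∀ {c a b d} → Claw G c a b d → Claw G c b a d
  claw-swap (ca , cb , cd , a≢b , a≢d , b≢d , ¬ab , ¬ad , ¬bd) =
    cb , ca , cd , ≢-sym a≢b , b≢d , a≢d , ¬adj-sym ¬ab , ¬bd , ¬ad

  claw-rotate : ∀ {c a b d} → Claw G c a b d → Claw G c b d a
  claw-rotate (ca , cb , cd , a≢b , a≢d , b≢d , ¬ab , ¬ad , ¬bd) =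
    cb , cd , ca , b≢d , ≢-sym a≢b , ≢-sym a≢d , ¬bd , ¬adj-sym ¬ab , ¬adj-sym ¬ad

  C4-rotate : ∀ {a b c d} → C4 G a b c d → C4 G b c d a
  C4-rotate (ab , bc , cd , da , a≢c , b≢d , ¬ac , ¬bd) =
    bc , cd , da , ab , b≢d , ≢-sym a≢c , ¬bd , ¬adj-sym ¬ac

  C4-reflect : ∀ {a b c d} → C4 G a b c d → C4 G a d c b
  C4-reflect (ab , bc , cd , da , a≢c , b≢d , ¬ac , ¬bd) =
    sym G da , sym G cd , sym G bc , sym G ab , a≢c , ≢-sym b≢d , ¬ac , ¬adj-sym ¬bd

  ClawPartner : Fin n → Fin n → Fin n → Set
  ClawPartner p q w = ∃[ c ] Claw G c p q w

  clawPartner? : ∀ p q → Decidable (ClawPartner p q)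
  clawPartner? p q w = any? λ c → claw? c p q w

  clawPartners : Fin n → Fin n → List (Fin n)
  clawPartners p q = filter (clawPartner? p q) (allFin n)

  witnesses : List (Fin n × Fin n) → List (Fin n)
  witnesses [] = []
  witnesses ((p , q) ∷ E) = p ∷ q ∷ clawPartners p q ++ witnesses E

  module _ {p q : Fin n} where

    fst∈witnesses : ∀ {E} → (p , q) ∈ E → p ∈ witnesses E
    fst∈witnesses {_ ∷ _} (here refl) = here refl
    fst∈witnesses {(p′ , q′) ∷ E} (there e∈E) =
      there (there (∈-++⁺ʳ (clawPartners p′ q′) (fst∈witnesses e∈E)))

    snd∈witnesses : ∀ {E} → (p , q) ∈ E → q ∈ witnesses E
    snd∈witnesses {_ ∷ _} (here refl) = there (here refl)
    snd∈witnesses {(p′ , q′) ∷ E} (there e∈E) =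
      there (there (∈-++⁺ʳ (clawPartners p′ q′) (snd∈witnesses e∈E)))

    partner∈witnesses : ∀ {E c w} → (p , q) ∈ E → Claw G c p q w → w ∈ witnesses E
    partner∈witnesses {_ ∷ _} {c} {w} (here refl) claw =
      there (there (∈-++⁺ˡ (∈-filter⁺ (clawPartner? p q) (∈-allFin w) (c , claw))))
    partner∈witnesses {(p′ , q′) ∷ E} (there e∈E) claw =
      there (there (∈-++⁺ʳ (clawPartners p′ q′) (partner∈witnesses e∈E claw)))

  length-witnesses : ∀ {k} → ClawBound G k → ∀ E → length (witnesses E) ≤ length E * (2 + k)
  length-witnesses bound [] = z≤n
  length-witnesses bound ((p , q) ∷ E) rewrite length-++ (clawPartners p q) {witnesses E} =
    s≤s (s≤s (+-mono-≤ partners≤k (length-witnesses bound E)))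
    where
    partners≤k = bound p q (clawPartners p q) (Unique.filter⁺ (clawPartner? p q) (Unique.allFin⁺ n))
                   (all-filter (clawPartner? p q) (allFin n))

  sortedPair : Fin n → Fin n → Fin n × Fin n
  sortedPair a b with toℕ a <? toℕ b
  ... | yes _ = a , b
  ... | no _  = b , a

  sortedPair-C4 : ∀ {p q a b} → C4 G p a q b →
    toℕ (proj₁ (sortedPair a b)) < toℕ (proj₂ (sortedPair a b)) ×
    C4 G p (proj₁ (sortedPair a b)) q (proj₂ (sortedPair a b))
  sortedPair-C4 {a = a} {b} c4 with toℕ a <? toℕ b
  ... | yes a<b = a<b , c4
  ... | no a≮b  = ≤∧≢⇒< (≮⇒≥ a≮b) (C4-diagonal≢ c4 ∘ ≡.sym ∘ toℕ-injective) , C4-reflect c4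

  sortedPair-≡ : ∀ {a b a′ b′} → sortedPair a b ≡ sortedPair a′ b′ →
    a ≡ a′ ⊎ (a ≡ b′ × b ≡ a′)
  sortedPair-≡ {a} {b} {a′} {b′} eq with toℕ a <? toℕ b | toℕ a′ <? toℕ b′ | eq
  ... | yes _ | yes _ | refl = inj₁ refl
  ... | yes _ | no _  | refl = inj₂ (refl , refl)
  ... | no _  | yes _ | refl = inj₂ (refl , refl)
  ... | no _  | no _  | refl = inj₁ refl

  Clique : List (Fin n) → Set
  Clique bs = ∀ x y → x ∈ bs → y ∈ bs → x ≢ y → Adj G x y

  CliqueC4Side : List (Fin n) → Fin n → Fin n → Fin n → Set
  CliqueC4Side bs p q x = x ∈ bs × ∃[ y ] C4 G p x q y

  -- Distinct clique vertices x have distinct diagonals {x, y}, as a diagonal is a non-edge.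
  module _ {bs : List (Fin n)} (clique : Clique bs) (p q : Fin n) where

    diagonals : ∀ {xs} → All (CliqueC4Side bs p q) xs → List (Fin n × Fin n)
    diagonals [] = []
    diagonals {x ∷ _} ((_ , y , _) ∷ sides) = sortedPair x y ∷ diagonals sides

    length-diagonals : ∀ {xs} (sides : All (CliqueC4Side bs p q) xs) → length (diagonals sides) ≡ length xs
    length-diagonals [] = refl
    length-diagonals (_ ∷ sides) = ≡.cong suc (length-diagonals sides)

    diagonals-C4 : ∀ {xs} (sides : All (CliqueC4Side bs p q) xs) →
      All (λ e → toℕ (proj₁ e) < toℕ (proj₂ e) × C4 G p (proj₁ e) q (proj₂ e)) (diagonals sides)
    diagonals-C4 [] = []
    diagonals-C4 ((_ , _ , c4) ∷ sides) = sortedPair-C4 c4 ∷ diagonals-C4 sides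

    diagonal-fresh : ∀ {x y xs} → x ∈ bs → (sides : All (CliqueC4Side bs p q) xs) →
      All (x ≢_) xs → All (sortedPair x y ≢_) (diagonals sides)
    diagonal-fresh x∈bs [] [] = []
    diagonal-fresh {x} {y} {x′ ∷ _} x∈bs ((x′∈bs , y′ , c4′) ∷ sides) (x≢x′ ∷ x≢xs) =
      (fresh ∘ sortedPair-≡) ∷ diagonal-fresh x∈bs sides x≢xs
      where
      fresh : x ≡ x′ ⊎ (x ≡ y′ × y ≡ x′) → ⊥
      fresh (inj₁ x≡x′) = x≢x′ x≡x′
      fresh (inj₂ (refl , refl)) = C4-¬adj₂₄ c4′ (clique x′ x x′∈bs x∈bs (≢-sym x≢x′))

    diagonals-unique : ∀ {xs} (sides : All (CliqueC4Side bs p q) xs) → Unique xs → Unique (diagonals sides)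
    diagonals-unique [] [] = []
    diagonals-unique ((x∈bs , _) ∷ sides) (x∉xs ∷ xs!) =
      diagonal-fresh x∈bs sides x∉xs ∷ diagonals-unique sides xs!

    clique-C4-sides≤ : ∀ {k} → C4Bound G k →
      ∀ xs → Unique xs → All (CliqueC4Side bs p q) xs → length xs ≤ k
    clique-C4-sides≤ bound [] _ _ = z≤n
    clique-C4-sides≤ {k} bound (_ ∷ _) xs! sides@((_ , _ , c4) ∷ _) =
      ≡.subst (_≤ k) (length-diagonals sides)
        (bound p q (C4-¬adj₁₃ c4) (diagonals sides) (diagonals-unique sides xs!) (diagonals-C4 sides))


module FillIn {n : ℕ} (G : Graph n) (F : List (Fin n × Fin n))
  (model : ProperInterval (AddEdges G F)) where

  open GraphFacts G

  private
    l = proj₁ model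
    r = proj₁ (proj₂ model)
    l≤r = proj₁ (proj₂ (proj₂ model))
    edge⇔meet = proj₁ (proj₂ (proj₂ (proj₂ model)))
    proper = proj₂ (proj₂ (proj₂ (proj₂ model)))

  open Intervals l r
  open Proper l≤r proper

  FillEdge : Fin n → Fin n → Set
  FillEdge p q = (p , q) ∈ F ⊎ (q , p) ∈ F

  W : List (Fin n)
  W = witnesses F

  fill-fst∈W : ∀ {p q} → FillEdge p q → p ∈ W
  fill-fst∈W (inj₁ pq∈F) = fst∈witnesses pq∈F
  fill-fst∈W (inj₂ qp∈F) = snd∈witnesses qp∈F

  fill-snd∈W : ∀ {p q} → FillEdge p q → q ∈ W
  fill-snd∈W (inj₁ pq∈F) = snd∈witnesses pq∈F
  fill-snd∈W (inj₂ qp∈F) = fst∈witnesses qp∈F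

  fill-partner∈W : ∀ {p q c w} → FillEdge p q → Claw G c p q w → w ∈ W
  fill-partner∈W (inj₁ pq∈F) claw = partner∈witnesses pq∈F claw
  fill-partner∈W (inj₂ qp∈F) claw = partner∈witnesses qp∈F (claw-swap claw)

  adj⇒meet : ∀ {u v} → Adj G u v → Meet u v
  adj⇒meet uv = Equivalence.to (edge⇔meet _ _ (adj⇒≢ uv)) (inj₁ uv)

  meet⇒fill : ∀ {u v} → u ≢ v → ¬ Adj G u v → Meet u v → FillEdge u v
  meet⇒fill u≢v ¬uv m with Equivalence.from (edge⇔meet _ _ u≢v) m
  ... | inj₁ uv   = ⊥-elim (¬uv uv)
  ... | inj₂ fill = fill

  meet⇒adj : ∀ {u v} → u ∉ W → u ≢ v → Meet u v → Adj G u v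
  meet⇒adj {u} {v} u∉W u≢v m with dec G u v
  ... | yes uv = uv
  ... | no ¬uv = ⊥-elim (u∉W (fill-fst∈W (meet⇒fill u≢v ¬uv m)))

  claw-fill : ∀ {c a b d} → Claw G c a b d → FillEdge a b ⊎ FillEdge a d ⊎ FillEdge b d
  claw-fill (ca , cb , cd , a≢b , a≢d , b≢d , ¬ab , ¬ad , ¬bd)
    with claw-free (adj⇒meet ca) (adj⇒meet cb) (adj⇒meet cd)
  ... | inj₁ ab        = inj₁ (meet⇒fill a≢b ¬ab ab)
  ... | inj₂ (inj₁ ad) = inj₂ (inj₁ (meet⇒fill a≢d ¬ad ad))
  ... | inj₂ (inj₂ bd) = inj₂ (inj₂ (meet⇒fill b≢d ¬bd bd))

  C4-fill : ∀ {a b c d} → C4 G a b c d → FillEdge a c ⊎ FillEdge b d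
  C4-fill {a} {b} {c} {d} (ab , bc , cd , da , a≢c , b≢d , ¬ac , ¬bd) with meet? a c
  ... | yes ac = inj₁ (meet⇒fill a≢c ¬ac ac)
  ... | no a∤c = inj₂ (meet⇒fill b≢d ¬bd
    (meet-across-gap a∤c (adj⇒meet ab) (meet-sym (adj⇒meet da)) (meet-sym (adj⇒meet bc)) (adj⇒meet cd)))

  fill-sym : ∀ {p q} → FillEdge p q → FillEdge q p
  fill-sym = swap

  claw-leaf∈W : ∀ {c a b d} → Claw G c a b d → a ∈ W
  claw-leaf∈W claw with claw-fill claw
  ... | inj₁ ab        = fill-fst∈W ab
  ... | inj₂ (inj₁ ad) = fill-fst∈W ad
  ... | inj₂ (inj₂ bd) = fill-partner∈W bd (claw-rotate claw)

  FillClawCentre : Fin n → Set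
  FillClawCentre x = ∃[ p ] ∃[ q ] ∃[ w ] (Claw G x p q w × FillEdge p q)

  claw-centre : ∀ {c a b d} → Claw G c a b d → FillClawCentre c
  claw-centre claw with claw-fill claw
  ... | inj₁ ab        = _ , _ , _ , claw , ab
  ... | inj₂ (inj₁ ad) = _ , _ , _ , claw-swap (claw-rotate (claw-rotate claw)) , ad
  ... | inj₂ (inj₂ bd) = _ , _ , _ , claw-rotate claw , bd

  claw-vertex : ∀ {x c a b d} → Claw G c a b d → (x ≡ c ⊎ x ≡ a ⊎ x ≡ b ⊎ x ≡ d) →
    x ∈ W ⊎ FillClawCentre x
  claw-vertex claw (inj₁ refl)               = inj₂ (claw-centre claw)
  claw-vertex claw (inj₂ (inj₁ refl))        = inj₁ (claw-leaf∈W claw)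
  claw-vertex claw (inj₂ (inj₂ (inj₁ refl))) = inj₁ (claw-leaf∈W (claw-rotate claw))
  claw-vertex claw (inj₂ (inj₂ (inj₂ refl))) = inj₁ (claw-leaf∈W (claw-rotate (claw-rotate claw)))

  OnFillC4 : Fin n → Set
  OnFillC4 x = Any (λ e → ∃[ y ] C4 G (proj₁ e) x (proj₂ e) y) F

  onFillC4? : Decidable OnFillC4
  onFillC4? x = Any.any? (λ e → any? (λ y → C4? (proj₁ e) x (proj₂ e) y)) F

  fill-C4 : ∀ {a x c y} → FillEdge a c → C4 G a x c y → OnFillC4 x
  fill-C4 {y = y} (inj₁ ac∈F) c4 = Any.map (λ { refl → y , c4 }) ac∈F
  fill-C4 {y = y} (inj₂ ca∈F) c4 = Any.map (λ { refl → y , C4-reflect (C4-rotate (C4-rotate c4)) }) ca∈F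

  C4-vertex : ∀ {x a b c d} → C4 G a b c d → (x ≡ a ⊎ x ≡ b ⊎ x ≡ c ⊎ x ≡ d) →
    x ∈ W ⊎ OnFillC4 x
  C4-vertex c4 x∈ with C4-fill c4 | x∈
  ... | inj₁ ac | inj₁ refl               = inj₁ (fill-fst∈W ac)
  ... | inj₁ ac | inj₂ (inj₁ refl)        = inj₂ (fill-C4 ac c4)
  ... | inj₁ ac | inj₂ (inj₂ (inj₁ refl)) = inj₁ (fill-snd∈W ac)
  ... | inj₁ ac | inj₂ (inj₂ (inj₂ refl)) = inj₂ (fill-C4 ac (C4-reflect c4))
  ... | inj₂ bd | inj₁ refl               = inj₂ (fill-C4 bd (C4-reflect (C4-rotate c4)))
  ... | inj₂ bd | inj₂ (inj₁ refl)        = inj₁ (fill-fst∈W bd)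
  ... | inj₂ bd | inj₂ (inj₂ (inj₁ refl)) = inj₂ (fill-C4 bd (C4-rotate c4))
  ... | inj₂ bd | inj₂ (inj₂ (inj₂ refl)) = inj₁ (fill-snd∈W bd)

  classify : ∀ {x} → x ∉ W → InClaw G x ⊎ InC4 G x → OnFillC4 x ⊎ FillClawCentre x
  classify x∉W (inj₁ (_ , _ , _ , _ , claw , x∈)) with claw-vertex claw x∈
  ... | inj₁ x∈W   = ⊥-elim (x∉W x∈W)
  ... | inj₂ centre = inj₂ centre
  classify x∉W (inj₂ (_ , _ , _ , _ , c4 , x∈)) with C4-vertex c4 x∈
  ... | inj₁ x∈W   = ⊥-elim (x∉W x∈W)
  ... | inj₂ onC4  = inj₁ onC4

  private
    ∉W⇒≢ : ∀ {u v} → u ∉ W → v ∈ W → u ≢ v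
    ∉W⇒≢ u∉W v∈W refl = u∉W v∈W

  -- Case z ~ a, z ≁ b of centre-neighbour: either x₁ z b w is a claw, so z ∈ W, or
  -- z and x₂ lie on either side of a gap bridged by a and w, which closes a filled C4.
  centre-neighbour-one-sided : ∀ {x₁ x₂ a b w z} → Claw G x₂ a b w → FillEdge a b → ¬ OnFillC4 x₂ →
    Adj G x₁ b → Adj G x₁ w → Adj G x₁ z → ¬ Adj G x₂ z → z ∉ W → z ≢ x₂ →
    Adj G z a → ¬ Adj G z b → ⊥
  centre-neighbour-one-sided {x₁} {x₂} {a} {b} {w} {z}
    (x₂a , _ , x₂w , _ , a≢w , b≢w , _ , ¬aw , ¬bw) ab ¬onC4
    x₁b x₁w x₁z ¬x₂z z∉W z≢x₂ za ¬zb
    with dec G z w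
  ... | no ¬zw = z∉W (claw-leaf∈W {x₁} {z} {b} {w}
        (x₁z , x₁b , x₁w , ∉W⇒≢ z∉W (fill-snd∈W ab) , (λ { refl → ¬x₂z x₂w }) , b≢w ,
         ¬zb , ¬zw , ¬bw))
  ... | yes zw = ¬onC4 (fill-C4 (meet⇒fill a≢w ¬aw aw)
        (sym G x₂a , x₂w , sym G zw , za , a≢w , ≢-sym z≢x₂ , ¬aw , ¬x₂z))
    where
    aw : Meet a w
    aw = meet-across-gap (λ m → ¬x₂z (sym G (meet⇒adj z∉W z≢x₂ m)))
           (adj⇒meet za) (adj⇒meet zw) (adj⇒meet x₂a) (adj⇒meet x₂w)

  centre-neighbour : ∀ {x₁ x₂ p q w z} → Claw G x₂ p q w → FillEdge p q → ¬ OnFillC4 x₂ →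
    Adj G x₁ p → Adj G x₁ q → Adj G x₁ w → Adj G x₁ z → z ∉ W → z ≢ x₂ → Adj G x₂ z
  centre-neighbour {x₁} {x₂} {p} {q} {w} {z} claw@(x₂p , x₂q , _ , p≢q , _ , _ , ¬pq , _ , _) pq ¬onC4
    x₁p x₁q x₁w x₁z z∉W z≢x₂
    with dec G x₂ z
  ... | yes x₂z = x₂z
  ... | no ¬x₂z with dec G z p | dec G z q
  ... | no ¬zp | no ¬zq = ⊥-elim (z∉W (claw-leaf∈W {x₁} {z} {p} {q}
        (x₁z , x₁p , x₁q , ∉W⇒≢ z∉W (fill-fst∈W pq) , ∉W⇒≢ z∉W (fill-snd∈W pq) , p≢q ,
         ¬zp , ¬zq , ¬pq)))
  ... | yes zp | yes zq = ⊥-elim (¬onC4 (fill-C4 pq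
        (sym G x₂p , x₂q , sym G zq , zp , p≢q , ≢-sym z≢x₂ , ¬pq , ¬x₂z)))
  ... | yes zp | no ¬zq = ⊥-elim
        (centre-neighbour-one-sided claw pq ¬onC4 x₁q x₁w x₁z ¬x₂z z∉W z≢x₂ zp ¬zq)
  ... | no ¬zp | yes zq = ⊥-elim
        (centre-neighbour-one-sided (claw-swap claw) (fill-sym pq) ¬onC4 x₁p x₁w x₁z ¬x₂z z∉W z≢x₂ zq ¬zp)

  module _ {bs : List (Fin n)} (clique : Clique bs) where

    open import Data.List.Membership.DecPropositional (_≟ᶠ_ {n}) using (_∈?_)

    AgreeOnWitnesses : Fin n → Fin n → Set
    AgreeOnWitnesses x y = ∀ {v} → v ∈ W → v ∉ bs → Adj G v x → Adj G v y

    witness-neighbour : ∀ {x₁ x₂ u} → x₁ ∈ bs → x₁ ∉ W → AgreeOnWitnesses x₂ x₁ →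
      u ∈ W → Adj G x₂ u → Adj G x₁ u
    witness-neighbour {x₁} {u = u} x₁∈bs x₁∉W agree u∈W x₂u with u ∈? bs
    ... | yes u∈bs = clique x₁ u x₁∈bs u∈bs (∉W⇒≢ x₁∉W u∈W)
    ... | no u∉bs  = sym G (agree u∈W u∉bs (sym G x₂u))

    closed-neighbourhood-⊆ : ∀ {x₁ x₂} → x₁ ∈ bs → x₂ ∈ bs → x₁ ∉ W →
      FillClawCentre x₂ → ¬ OnFillC4 x₂ → AgreeOnWitnesses x₁ x₂ → AgreeOnWitnesses x₂ x₁ →
      ∀ w → (w ≡ x₁ ⊎ Adj G x₁ w) → (w ≡ x₂ ⊎ Adj G x₂ w)
    closed-neighbourhood-⊆ {x₁} {x₂} x₁∈bs x₂∈bs _ _ _ _ _ w (inj₁ refl) with x₁ ≟ᶠ x₂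
    ... | yes x₁≡x₂ = inj₁ x₁≡x₂
    ... | no x₁≢x₂  = inj₂ (clique x₂ x₁ x₂∈bs x₁∈bs (≢-sym x₁≢x₂))
    closed-neighbourhood-⊆ {x₁} {x₂} x₁∈bs x₂∈bs x₁∉W (_ , _ , _ , claw , pq) ¬onC4 agree₁₂ agree₂₁
      w (inj₂ x₁w)
      with w ≟ᶠ x₂
    ... | yes w≡x₂ = inj₁ w≡x₂
    ... | no w≢x₂ with w ∈? bs | w ∈? W
    ... | yes w∈bs | _      = inj₂ (clique x₂ w x₂∈bs w∈bs (≢-sym w≢x₂))
    ... | no w∉bs  | yes w∈W = inj₂ (sym G (agree₁₂ w∈W w∉bs (sym G x₁w)))
    ... | no _     | no w∉W  = inj₂ (centre-neighbour claw pq ¬onC4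
          (sees (fill-fst∈W pq) (proj₁ claw)) (sees (fill-snd∈W pq) (proj₁ (proj₂ claw)))
          (sees (fill-partner∈W pq claw) (proj₁ (proj₂ (proj₂ claw)))) x₁w w∉W w≢x₂)
      where
      sees : ∀ {u} → u ∈ W → Adj G x₂ u → Adj G x₁ u
      sees = witness-neighbour x₁∈bs x₁∉W agree₂₁

    fill-centres-twins : ∀ {x₁ x₂} → x₁ ∈ bs → x₂ ∈ bs → x₁ ∉ W → x₂ ∉ W →
      FillClawCentre x₁ → FillClawCentre x₂ → ¬ OnFillC4 x₁ → ¬ OnFillC4 x₂ →
      AgreeOnWitnesses x₁ x₂ → AgreeOnWitnesses x₂ x₁ → TrueTwins G x₁ x₂
    fill-centres-twins x₁∈bs x₂∈bs x₁∉W x₂∉W c₁ c₂ ¬onC4₁ ¬onC4₂ agree₁₂ agree₂₁ w = mk⇔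
      (closed-neighbourhood-⊆ x₁∈bs x₂∈bs x₁∉W c₂ ¬onC4₂ agree₁₂ agree₂₁ w)
      (closed-neighbourhood-⊆ x₂∈bs x₁∈bs x₂∉W c₁ ¬onC4₁ agree₂₁ agree₁₂ w)


threshold-side : ∀ {m} {P : Fin m → Set} {j} {i i′ : Fin m} →
  (∀ i → P i ⇔ toℕ i < j) ⊎ (∀ i → P i ⇔ j ≤ toℕ i) →
  (j ≤ toℕ i → j ≤ toℕ i′) → (j ≤ toℕ i′ → j ≤ toℕ i) → P i → P i′
threshold-side {j = j} {i} {i′} (inj₁ prefix) _ back Pi with j ≤? toℕ i′
... | yes j≤i′ = ⊥-elim (<⇒≱ (Equivalence.to (prefix i) Pi) (back j≤i′))
... | no j≰i′  = Equivalence.from (prefix i′) (≰⇒> j≰i′)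
threshold-side (inj₂ suffix) forth _ Pi =
  Equivalence.from (suffix _) (forth (Equivalence.to (suffix _) Pi))

-- Since N(v) ∩ B is cut out of the order of B by threshold v, the signature of
-- x ∈ B over O (the number of v ∈ O whose threshold is at most the position of x)
-- is monotone along B, and two vertices with equal signatures lie on the same side
-- of every threshold. Off B, position and threshold are junk values 0.
module Signature {n : ℕ} (G : Graph n) (bs : List (Fin n)) (kjoin : KJoin G bs) where

  open import Data.List.Membership.DecPropositional (_≟ᶠ_ {n}) using (_∈?_)

  position : Fin n → ℕ
  position x with x ∈? bs
  ... | yes x∈bs = toℕ (Any.index x∈bs)
  ... | no _     = 0

  position-lookup : ∀ {x} → x ∈ bs → ∃[ i ] (lookup bs i ≡ x × toℕ i ≡ position x)
  position-lookup {x} x∈bs with x ∈? bs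
  ... | yes x∈bs′ = Any.index x∈bs′ , ≡.sym (lookup-index x∈bs′) , refl
  ... | no x∉bs   = ⊥-elim (x∉bs x∈bs)

  threshold : Fin n → ℕ
  threshold v with v ∈? bs
  ... | yes _    = 0
  ... | no v∉bs = proj₁ (proj₂ (proj₂ kjoin) v v∉bs)

  threshold-sides : ∀ {v} → v ∉ bs →
    (∀ i → Adj G v (lookup bs i) ⇔ toℕ i < threshold v) ⊎
    (∀ i → Adj G v (lookup bs i) ⇔ threshold v ≤ toℕ i)
  threshold-sides {v} v∉bs with v ∈? bs
  ... | yes v∈bs  = ⊥-elim (v∉bs v∈bs)
  ... | no v∉bs′ = proj₂ (proj₂ (proj₂ kjoin) v v∉bs′)

  above : Fin n → Fin n → ℕ
  above v x with threshold v ≤? position x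
  ... | yes _ = 1
  ... | no _  = 0

  above≤1 : ∀ v x → above v x ≤ 1
  above≤1 v x with threshold v ≤? position x
  ... | yes _ = ≤-refl
  ... | no _  = z≤n

  above-mono : ∀ {x y} → position x ≤ position y → ∀ v → above v x ≤ above v y
  above-mono {x} {y} px≤py v with threshold v ≤? position x | threshold v ≤? position y
  ... | yes _    | yes _   = ≤-refl
  ... | yes t≤px | no t≰py = ⊥-elim (t≰py (≤-trans t≤px px≤py))
  ... | no _     | _       = z≤n

  above-≡⇒side : ∀ {v x y} → above v x ≡ above v y →
    threshold v ≤ position x → threshold v ≤ position y
  above-≡⇒side {v} {x} {y} eq with threshold v ≤? position x | threshold v ≤? position y | eq
  ... | _ | yes t≤py | _    = λ _ → t≤py
  ... | no t≰px | no _ | _  = λ t≤px → ⊥-elim (t≰px t≤px)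

  signature : List (Fin n) → Fin n → ℕ
  signature O x = sum (map (λ v → above v x) O)

  signature≤length : ∀ O x → signature O x ≤ length O
  signature≤length [] x = z≤n
  signature≤length (v ∷ O) x = +-mono-≤ (above≤1 v x) (signature≤length O x)

  signature-≡⇒above-≡ : ∀ {O x y v} → signature O x ≡ signature O y → v ∈ O → above v x ≡ above v y
  signature-≡⇒above-≡ {O} {x} {y} eq v∈O with ≤-total (position x) (position y)
  ... | inj₁ px≤py = sum-map-≡⇒≡ _ _ (above-mono px≤py) O eq v∈O
  ... | inj₂ py≤px = ≡.sym (sum-map-≡⇒≡ _ _ (above-mono py≤px) O (≡.sym eq) v∈O)

  signature-≡⇒agree : ∀ {O x y v} → x ∈ bs → y ∈ bs → signature O x ≡ signature O y →
    v ∈ O → v ∉ bs → Adj G v x → Adj G v y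
  signature-≡⇒agree {x = x} {y} {v} x∈bs y∈bs eq v∈O v∉bs vx
    with position-lookup x∈bs | position-lookup y∈bs
  ... | i , refl , i≡px | i′ , refl , i′≡py =
    threshold-side (threshold-sides v∉bs)
      (λ t≤i → ≡.subst (_ ≤_) (≡.sym i′≡py) (above-≡⇒side above-eq (≡.subst (_ ≤_) i≡px t≤i)))
      (λ t≤i′ → ≡.subst (_ ≤_) (≡.sym i≡px) (above-≡⇒side (≡.sym above-eq) (≡.subst (_ ≤_) i′≡py t≤i′)))
      vx
    where
    above-eq = signature-≡⇒above-≡ eq v∈O


module KJoinCount {n : ℕ} (G : Graph n) (k : ℕ) (F : List (Fin n × Fin n))
  (model : ProperInterval (AddEdges G F)) (bs : List (Fin n)) (kjoin : KJoin G bs) where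

  open GraphFacts G
  open FillIn G F model
  open Signature G bs kjoin
  open import Data.List.Membership.DecPropositional (_≟ᶠ_ {n}) using (_∈?_)

  private
    clique : Clique bs
    clique = proj₁ (proj₂ kjoin)

  insideW outsideW : List (Fin n)
  insideW  = filter (_∈? bs) W
  outsideW = filter (¬? ∘ (_∈? bs)) W

  witnesses-in-B≤ : ∀ ys → Unique ys → All (λ y → y ∈ bs × y ∈ W) ys → length ys ≤ length insideW
  witnesses-in-B≤ ys ys! ys-ok = Unique-⊆⇒length≤ _≟ᶠ_ ys! λ y∈ys →
    let y∈bs , y∈W = All.lookup ys-ok y∈ys in ∈-filter⁺ (_∈? bs) y∈W y∈bs

  C4-sides-in-B≤ : C4Bound G k → ∀ ys → Unique ys → All (λ y → y ∈ bs × OnFillC4 y) ys →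
    length ys ≤ length F * k
  C4-sides-in-B≤ c4-bound ys ys! ys-ok =
    length≤-cover side? k F (λ {e} _ → clique-C4-sides≤ clique (proj₁ e) (proj₂ e) c4-bound) ys ys!
      (All.map (λ (y∈bs , onC4) → Any.map (λ (y′ , c4) → y∈bs , y′ , c4) onC4) ys-ok)
    where
    side? = λ e y → (y ∈? bs) ×-dec any? (λ y′ → C4? (proj₁ e) y (proj₂ e) y′)

  FillCentreInB : Fin n → Set
  FillCentreInB y = y ∈ bs × y ∉ W × ¬ OnFillC4 y × FillClawCentre y

  fill-centres-in-B≤ : TwinBound G (k + 1) → ∀ ys → Unique ys → All FillCentreInB ys →
    length ys ≤ suc (length outsideW) * (k + 1)
  fill-centres-in-B≤ twin-bound ys ys! ys-ok =
    length≤-fibres (k + 1) twin-bound (signature outsideW) (suc (length outsideW)) ys ys!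
      (All.tabulate λ {y} _ → s≤s (signature≤length outsideW y))
      twins
    where
    agree : ∀ {x y} → x ∈ bs → y ∈ bs → signature outsideW x ≡ signature outsideW y →
      AgreeOnWitnesses clique x y
    agree x∈bs y∈bs eq v∈W v∉bs =
      signature-≡⇒agree x∈bs y∈bs eq (∈-filter⁺ (¬? ∘ (_∈? bs)) v∈W v∉bs) v∉bs
    twins : ∀ {y y′} → y ∈ ys → y′ ∈ ys → signature outsideW y ≡ signature outsideW y′ →
      TrueTwins G y y′
    twins y∈ y′∈ eq with All.lookup ys-ok y∈ | All.lookup ys-ok y′∈
    ... | y∈bs , y∉W , ¬onC4 , centre | y′∈bs , y′∉W , ¬onC4′ , centre′ =
      fill-centres-twins clique y∈bs y′∈bs y∉W y′∉W centre centre′ ¬onC4 ¬onC4′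
        (agree y∈bs y′∈bs eq) (agree y′∈bs y∈bs (≡.sym eq))

  claws-and-C4s-in-B≤ : TwinBound G (k + 1) → C4Bound G k → ∀ xs → Unique xs →
    All (λ x → x ∈ bs × (InClaw G x ⊎ InC4 G x)) xs →
    length xs ≤ length insideW + (length F * k + suc (length outsideW) * (k + 1))
  claws-and-C4s-in-B≤ twin-bound c4-bound xs xs! xs-ok = begin
    length xs                                    ≡⟨ length-filter-split (_∈? W) xs ⟩
    length XW + length R                         ≡⟨ ≡.cong (length XW +_) (length-filter-split onFillC4? R) ⟩
    length XW + (length XM + length XC)          ≤⟨ +-mono-≤ (witnesses-in-B≤ XW XW! XW-ok)
                                                      (+-mono-≤ (C4-sides-in-B≤ c4-bound XM XM! XM-ok)
                                                                (fill-centres-in-B≤ twin-bound XC XC! XC-ok)) ⟩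
    length insideW + (length F * k + suc (length outsideW) * (k + 1)) ∎
    where
    open ≤-Reasoning
    R  = filter (¬? ∘ (_∈? W)) xs
    XW = filter (_∈? W) xs
    XM = filter onFillC4? R
    XC = filter (¬? ∘ onFillC4?) R
    R! = Unique.filter⁺ (¬? ∘ (_∈? W)) xs!
    XW! = Unique.filter⁺ (_∈? W) xs!
    XM! = Unique.filter⁺ onFillC4? R!
    XC! = Unique.filter⁺ (¬? ∘ onFillC4?) R!
    R-ok = All-∩-filter (¬? ∘ (_∈? W)) xs-ok
    XW-ok = All-∩-filter (_∈? W) (All.map proj₁ xs-ok)
    XM-ok = All-∩-filter onFillC4? (All.map (proj₁ ∘ proj₁) R-ok)
    XC-ok : All FillCentreInB XC
    XC-ok = All.map (λ (((x∈bs , claw-or-C4) , x∉W) , ¬onC4) →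
                       x∈bs , x∉W , ¬onC4 , [ ⊥-elim ∘ ¬onC4 , id ]′ (classify x∉W claw-or-C4))
                    (All-∩-filter (¬? ∘ onFillC4?) R-ok)

polynomial-bound : ∀ k s t m {x} → s + t ≤ k * (2 + k) → m ≤ k * k →
  x ≤ s + (m + suc t * (k + 1)) → x ≤ k ^ 3 + 4 * k ^ 2 + 5 * k + 1
polynomial-bound k s t m {x} s+t≤ m≤ x≤ = ≤-trans x≤ (begin
  s + (m + suc t * (k + 1))                   ≤⟨ +-mono-≤ (m≤m+n s (s * k)) (+-monoˡ-≤ _ m≤) ⟩
  (s + s * k) + (k * k + suc t * (k + 1))     ≡⟨ regroup s t k ⟩
  suc (s + t) * (k + 1) + k * k               ≤⟨ +-monoˡ-≤ (k * k) (*-monoˡ-≤ (k + 1) (s≤s s+t≤)) ⟩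
  suc (k * (2 + k)) * (k + 1) + k * k         ≤⟨ m≤m+n _ (k + k) ⟩
  suc (k * (2 + k)) * (k + 1) + k * k + (k + k) ≡⟨ expand k ⟩
  k * (k * (k * 1)) + 4 * (k * (k * 1)) + 5 * k + 1 ∎)
  where
  open ≤-Reasoning
  regroup : ∀ s t k → (s + s * k) + (k * k + suc t * (k + 1)) ≡ suc (s + t) * (k + 1) + k * k
  regroup = solve-∀
  -- The solver does not read _^_, so the target is written with k ^ 3 unfolded.
  expand : ∀ k → suc (k * (2 + k)) * (k + 1) + k * k + (k + k) ≡ k * (k * (k * 1)) + 4 * (k * (k * 1)) + 5 * k + 1
  expand = solve-∀


lemma3 : ∀ {n : ℕ} (G : Graph n) (k : ℕ) →
    HasCompletion G k →
    TwinBound G (k + 1) →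
    ClawBound G k →
    C4Bound G k →
    (bs : List (Fin n)) → KJoin G bs →
    (xs : List (Fin n)) → Unique xs →
    All (λ x → x ∈ bs × (InClaw G x ⊎ InC4 G x)) xs →
    length xs ≤ k ^ 3 + 4 * k ^ 2 + 5 * k + 1
lemma3 G k (F , |F|≤k , _ , model) twin-bound claw-bound c4-bound bs kjoin xs xs! xs-ok =
  polynomial-bound k (length insideW) (length outsideW) (length F * k)
    |W|≤ (*-monoˡ-≤ k |F|≤k)
    (claws-and-C4s-in-B≤ twin-bound c4-bound xs xs! xs-ok)
  where
  open KJoinCount G k F model bs kjoin
  open GraphFacts G using (witnesses; length-witnesses)
  |W|≤ : length insideW + length outsideW ≤ k * (2 + k)
  |W|≤ = ≤-trans (≤-reflexive (≡.sym (length-filter-split _ (witnesses F))))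
           (≤-trans (length-witnesses claw-bound F) (*-monoˡ-≤ (2 + k) |F|≤k))
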